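{- Let $\Sigma=\{0,1,2,3\}$, let $S\subset\Sigma^n$ be a double-MDS-code, and let $\gamma$ be the number of prime double-codes included in $S$. (a) If the adjacency graph $G(S)$ is bipartite, then $S$ includes exactly $2^\gamma$ different $(n,2)_4$ MDS codes. (b) Otherwise, $S$ does not include any $(n,2)_4$ MDS code.
   Context: A line of $\Sigma^n$ is a set of four words differing only in one fixed coordinate. An $(n,2)_4$ MDS code meets every line in exactly one element. A double-code meets every line in $0$ or $2$ elements; a double-MDS-code meets every line in exactly $2$ elements. A double-code is complementable if it is a subset of some double-MDS-code, and prime if it is complementable, nonempty, and cannot be split into more than one nonempty double-codes. The adjacency graph $G(S)$ has vertex set $S$, with edges between words differing in exactly one coordinate. -}

module Defs where

open import Data.Nat using (ℕ; zero; suc; _+_; _≤_)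
import Data.Fin
open import Data.Fin using (Fin)
open import Data.Fin.Patterns using (0F; 1F; 2F; 3F)
open import Data.Bool using (Bool; true; false; if_then_else_)
open import Data.Vec using (Vec; []; _∷_; _[_]≔_)
open import Data.List using (List; []; _∷_; length)
open import Data.List.Relation.Unary.All using (All)
open import Data.List.Relation.Unary.Any using (Any)
open import Data.List.Relation.Unary.AllPairs using (AllPairs)
open import Data.Product using (Σ; ∃; _×_; _,_)
open import Data.Sum using (_⊎_)
open import Relation.Binary.PropositionalEquality using (_≡_; _≢_)
open import Relation.Nullary using (¬_; yes; no)

Alphabet : Set
Alphabet = Fin 4

Word : ℕ → Set
Word n = Vec Alphabet n

WSet : ℕ → Set
WSet n = Word n → Bool

b2n : Bool → ℕ
b2n true  = 1
b2n false = 0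

-- Number of elements of S on the line through x in direction i,
-- i.e. the line { x with coordinate i replaced by a | a ∈ Σ }.
lineCount : {n : ℕ} → WSet n → Word n → Fin n → ℕ
lineCount S x i =
  b2n (S (x [ i ]≔ 0F)) + b2n (S (x [ i ]≔ 1F)) +
  b2n (S (x [ i ]≔ 2F)) + b2n (S (x [ i ]≔ 3F))

IsMDS : {n : ℕ} → WSet n → Set
IsMDS S = ∀ x i → lineCount S x i ≡ 1

IsDoubleCode : {n : ℕ} → WSet n → Set
IsDoubleCode S = ∀ x i → lineCount S x i ≡ 0 ⊎ lineCount S x i ≡ 2

IsDoubleMDS : {n : ℕ} → WSet n → Set
IsDoubleMDS S = ∀ x i → lineCount S x i ≡ 2

_⊆_ : {n : ℕ} → WSet n → WSet n → Set
A ⊆ B = ∀ x → A x ≡ true → B x ≡ true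

_≐_ : {n : ℕ} → WSet n → WSet n → Set
A ≐ B = ∀ x → A x ≡ B x

Nonempty : {n : ℕ} → WSet n → Set
Nonempty A = ∃ λ x → A x ≡ true

IsComplementable : {n : ℕ} → WSet n → Set
IsComplementable D = IsDoubleCode D × (∃ λ S → IsDoubleMDS S × D ⊆ S)

countIn : {n : ℕ} → List (WSet n) → Word n → ℕ
countIn []       x = 0
countIn (P ∷ Ps) x = b2n (P x) + countIn Ps x

-- D is split into the (pairwise disjoint) parts Ps:
-- each element of D lies in exactly one part, no other word lies in any part
IsSplitting : {n : ℕ} → WSet n → List (WSet n) → Set
IsSplitting D Ps = ∀ x → countIn Ps x ≡ b2n (D x)

IsSplittable : {n : ℕ} → WSet n → Set
IsSplittable {n} D = Σ (List (WSet n)) λ Ps →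
  (2 ≤ length Ps) × All (λ P → IsDoubleCode P × Nonempty P) Ps × IsSplitting D Ps

IsPrime : {n : ℕ} → WSet n → Set
IsPrime D = IsComplementable D × Nonempty D × ¬ IsSplittable D

dist : {n : ℕ} → Word n → Word n → ℕ
dist []       []       = 0
dist (a ∷ u) (b ∷ v) with a Data.Fin.≟ b
... | yes _ = dist u v
... | no  _ = suc (dist u v)

Adjacent : {n : ℕ} → Word n → Word n → Set
Adjacent u v = dist u v ≡ 1

IsBipartite : {n : ℕ} → WSet n → Set
IsBipartite {n} S = Σ (Word n → Bool) λ c →
  ∀ u v → S u ≡ true → S v ≡ true → Adjacent u v → c u ≢ c v

HasCount : {n : ℕ} → (WSet n → Set) → ℕ → Set
HasCount {n} P k = Σ (List (WSet n)) λ L →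
  (length L ≡ k) × All P L × AllPairs (λ A B → ¬ (A ≐ B)) L ×
  (∀ C → P C → Any (λ A → C ≐ A) L)

{-# OPTIONS --safe #-}

-- Every line meets S in two words, and two words of S are adjacent exactly when they lie on a
-- common line. A subset of S meets a line in 0 or 2 words iff it contains both words of S there
-- or neither, and in exactly 1 word iff it separates them. So the double-codes inside S are the
-- sets constant along the edges of G(S), and the MDS codes inside S are the colour classes of
-- proper 2-colourings of G(S); this gives (b).
-- An edge-constant function is constant on each prime double-code (otherwise it would split it),
-- so two primes that meet coincide, and every word of S lies in a prime, since by induction on
-- size every nonempty double-code contains one. Hence the edge-constant functions on S are
-- exactly the sums of subfamilies of the γ primes, and these 2^γ sums are pairwise distinct on S.
-- For a proper 2-colouring c, C ↦ c ⊕ C maps the MDS codes inside S bijectively onto them.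

module Submission where

open import Defs
open import Data.Nat using (ℕ; zero; suc; _+_; _^_; _≤_; _<_; z≤n; s≤s)
open import Data.Nat.Properties
  using (+-mono-≤; +-mono-<-≤; +-mono-≤-<; <-≤-trans; ≤-pred; ≤-refl; +-identityʳ; suc-injective)
  renaming (_≟_ to _≟ℕ_)
open import Data.Fin using (Fin; zero; suc)
import Data.Fin as Fin
open import Data.Fin.Patterns using (0F; 1F; 2F; 3F)
open import Data.Fin.Properties using (all?)
open import Data.Fin.Subset.Properties using (anySubset?)
open import Data.Bool using (Bool; true; false; _∧_; _∨_; not; _xor_)
import Data.Bool as Bool
open import Data.Bool.Properties
  using ( ∧-conicalˡ; ∧-conicalʳ; ∨-zeroʳ; not-involutive; not-injective; not-¬; ¬-not
        ; xor-comm; ⇔→≡)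
open import Data.Vec using (Vec; []; _∷_; _[_]≔_; lookup; tabulate)
open import Data.Vec.Properties using ([]≔-lookup; lookup∘tabulate)
open import Data.List using (List; []; _∷_; length; map; _++_; foldr)
open import Data.List.Properties using (length-map; length-++)
open import Data.List.Relation.Unary.All as All using (All; []; _∷_)
import Data.List.Relation.Unary.All.Properties as All
open import Data.List.Relation.Unary.Any as Any using (Any; here; there)
import Data.List.Relation.Unary.Any.Properties as Any
open import Data.List.Relation.Unary.AllPairs as AllPairs using (AllPairs; []; _∷_)
import Data.List.Relation.Unary.AllPairs.Properties as AllPairs
open import Data.Product using (∃; _×_; _,_; proj₁; proj₂; uncurry)
open import Data.Sum using (_⊎_)
open import Data.Empty using (⊥-elim)
open import Data.Unit using (tt)
open import Function using (_∘_)
open import Function.Bundles using (_⇔_; mk⇔; Equivalence)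
open import Relation.Binary.PropositionalEquality
open import Relation.Nullary using (¬_; Dec; ¬?; contradiction; yes; no)
open import Relation.Nullary.Decidable
  using (map′; _×-dec_; _→-dec_; _⊎-dec_; decidable-stable; toWitness)

open Equivalence using (to; from)

private
  variable
    n : ℕ

xor-cancelˡ : ∀ x {y z} → x xor y ≡ x xor z → y ≡ z
xor-cancelˡ false e = e
xor-cancelˡ true  e = not-injective e

xor-cancelʳ : ∀ {x y} z → x xor z ≡ y xor z → x ≡ y
xor-cancelʳ {x} {y} z e = xor-cancelˡ z (trans (xor-comm z x) (trans e (xor-comm y z)))

xor-involutiveˡ : ∀ x y → x xor (x xor y) ≡ y
xor-involutiveˡ false y = refl
xor-involutiveˡ true  y = not-involutive y

xor-≢ : ∀ {x y u v} → x ≢ y → u ≢ v → x xor u ≡ y xor v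
xor-≢ {y = y} {v = v} x≢y u≢v rewrite ¬-not x≢y | ¬-not u≢v with y | v
... | false | false = refl
... | false | true  = refl
... | true  | false = refl
... | true  | true  = refl

suc≡b2n⇒true : ∀ {m c} → suc m ≡ b2n c → c ≡ true
suc≡b2n⇒true {c = true} _ = refl

b2n-+-suc : ∀ a {m c} → b2n a + suc m ≡ b2n c → a ≡ false × c ≡ true
b2n-+-suc false e = refl , suc≡b2n⇒true e
b2n-+-suc true {c = true}  ()
b2n-+-suc true {c = false} ()

b2n-∧-split : ∀ d b → b2n (d ∧ b) + (b2n (d ∧ not b) + 0) ≡ b2n d
b2n-∧-split true  true  = refl
b2n-∧-split true  false = refl
b2n-∧-split false _     = refl

ConstantOn : {A : Set} → (A → Bool) → (A → Bool) → Set
ConstantOn X f = ∀ y z → X y ≡ true → X z ≡ true → f y ≡ f z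

InjectiveOn : {A : Set} → (A → Bool) → (A → Bool) → Set
InjectiveOn X f = ∀ y z → y ≢ z → X y ≡ true → X z ≡ true → f y ≢ f z

module _ {A : Set} {X f : A → Bool} where

  constantOn-zip : ∀ {g} (_∙_ : Bool → Bool → Bool) → ConstantOn X f → ConstantOn X g →
                   ConstantOn X (λ y → f y ∙ g y)
  constantOn-zip _∙_ cf cg y z Xy Xz = cong₂ _∙_ (cf y z Xy Xz) (cg y z Xy Xz)

  injectiveOn-xor-constantOn : ∀ {g} → InjectiveOn X f → ConstantOn X g →
                               InjectiveOn X (λ y → f y xor g y)
  injectiveOn-xor-constantOn {g} if cg y z y≢z Xy Xz e =
    if y z y≢z Xy Xz (xor-cancelʳ (g z) (subst (λ b → f y xor b ≡ f z xor g z) (cg y z Xy Xz) e))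

  injectiveOn-∧ : InjectiveOn X f → InjectiveOn X (λ y → X y ∧ f y)
  injectiveOn-∧ if y z y≢z Xy Xz e =
    if y z y≢z Xy Xz (subst₂ (λ a b → a ∧ f y ≡ b ∧ f z) Xy Xz e)

Line : Set
Line = Fin 4 → Bool

∑₄ : (Fin 4 → ℕ) → ℕ
∑₄ f = f 0F + f 1F + f 2F + f 3F

module _ {f g : Fin 4 → ℕ} (f≤g : ∀ a → f a ≤ g a) where

  ∑₄-mono-≤ : ∑₄ f ≤ ∑₄ g
  ∑₄-mono-≤ = +-mono-≤ (+-mono-≤ (+-mono-≤ (f≤g 0F) (f≤g 1F)) (f≤g 2F)) (f≤g 3F)

  ∑₄-mono-< : ∀ a → f a < g a → ∑₄ f < ∑₄ g
  ∑₄-mono-< 0F f<g = +-mono-<-≤ (+-mono-<-≤ (+-mono-<-≤ f<g (f≤g 1F)) (f≤g 2F)) (f≤g 3F)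
  ∑₄-mono-< 1F f<g = +-mono-<-≤ (+-mono-<-≤ (+-mono-≤-< (f≤g 0F) f<g) (f≤g 2F)) (f≤g 3F)
  ∑₄-mono-< 2F f<g = +-mono-<-≤ (+-mono-≤-< (+-mono-≤ (f≤g 0F) (f≤g 1F)) f<g) (f≤g 3F)
  ∑₄-mono-< 3F f<g = +-mono-≤-< (+-mono-≤ (+-mono-≤ (f≤g 0F) (f≤g 1F)) (f≤g 2F)) f<g

count : Line → ℕ
count ℓ = ∑₄ (b2n ∘ ℓ)

_⊆ₗ_ : Line → Line → Set
d ⊆ₗ s = ∀ a → d a ≡ true → s a ≡ true

injectiveOn-xor : {s f g : Line} → InjectiveOn s f → InjectiveOn s g →
                  ConstantOn s (λ a → f a xor g a)
injectiveOn-xor if ig a b sa sb with a Fin.≟ b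
... | yes refl = refl
... | no a≢b   = xor-≢ (if a b a≢b sa sb) (ig a b a≢b sa sb)

ZeroOrTwo : ℕ → Set
ZeroOrTwo k = k ≡ 0 ⊎ k ≡ 2

LineLaws : Line → Line → Set
LineLaws s d = count s ≡ 2 → d ⊆ₗ s →
  (ZeroOrTwo (count d) ⇔ ConstantOn s d) × (count d ≡ 1 ⇔ InjectiveOn s d)

_⇔?_ : {A B : Set} → Dec A → Dec B → Dec (A ⇔ B)
a? ⇔? b? = map′ (uncurry mk⇔) (λ e → to e , from e) ((a? →-dec b?) ×-dec (b? →-dec a?))

all-vec? : ∀ {k} {P : Vec Bool k → Set} → (∀ v → Dec (P v)) → Dec (∀ v → P v)
all-vec? P? = map′ (λ ∄¬P v → decidable-stable (P? v) (∄¬P ∘ (v ,_)))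
                   (λ ∀P (v , ¬Pv) → ¬Pv (∀P v))
                   (¬? (anySubset? (¬? ∘ P?)))

lineLaws? : ∀ s d → Dec (LineLaws s d)
lineLaws? s d =
  (count s ≟ℕ 2) →-dec ⊆? →-dec
  ((zeroOrTwo? ⇔? constantOn?) ×-dec ((count d ≟ℕ 1) ⇔? injectiveOn?))
  where
    ⊆? = all? λ a → (d a Bool.≟ true) →-dec (s a Bool.≟ true)
    zeroOrTwo? = (count d ≟ℕ 0) ⊎-dec (count d ≟ℕ 2)
    constantOn? = all? λ a → all? λ b →
      (s a Bool.≟ true) →-dec (s b Bool.≟ true) →-dec (d a Bool.≟ d b)
    injectiveOn? = all? λ a → all? λ b →
      ¬? (a Fin.≟ b) →-dec (s a Bool.≟ true) →-dec (s b Bool.≟ true) →-dec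
      ¬? (d a Bool.≟ d b)

lineLaws-enumerated : ∀ (s d : Vec Bool 4) → LineLaws (lookup s) (lookup d)
lineLaws-enumerated =
  toWitness {a? = all-vec? λ s → all-vec? λ d → lineLaws? (lookup s) (lookup d)} tt

module _ {s s′ d d′ : Line} (s≗ : s ≗ s′) (d≗ : d ≗ d′) where

  ⊆ₗ-resp-≗ : d ⊆ₗ s → d′ ⊆ₗ s′
  ⊆ₗ-resp-≗ d⊆s a e = trans (sym (s≗ a)) (d⊆s a (trans (d≗ a) e))

  constantOn-resp-≗ : ConstantOn s d → ConstantOn s′ d′
  constantOn-resp-≗ c a b sa sb =
    trans (sym (d≗ a)) (trans (c a b (trans (s≗ a) sa) (trans (s≗ b) sb)) (d≗ b))

  injectiveOn-resp-≗ : InjectiveOn s d → InjectiveOn s′ d′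
  injectiveOn-resp-≗ i a b a≢b sa sb e =
    i a b a≢b (trans (s≗ a) sa) (trans (s≗ b) sb) (trans (d≗ a) (trans e (sym (d≗ b))))

-- `lookup (tabulate s)` agrees with s definitionally at 0F … 3F, so `count` is unchanged and
-- only the pointwise conditions have to be transported.
lineLaws : ∀ s d → LineLaws s d
lineLaws s d s-two d⊆s =
  mk⇔ (constantOn-resp-≗ qs qd ∘ to double) (from double ∘ constantOn-resp-≗ qs⁻ qd⁻) ,
  mk⇔ (injectiveOn-resp-≗ qs qd ∘ to single) (from single ∘ injectiveOn-resp-≗ qs⁻ qd⁻)
  where
    qs = lookup∘tabulate s
    qd = lookup∘tabulate d
    qs⁻ = sym ∘ qs
    qd⁻ = sym ∘ qd
    laws = lineLaws-enumerated (tabulate s) (tabulate d) s-two (⊆ₗ-resp-≗ qs⁻ qd⁻ d⊆s)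
    double = proj₁ laws
    single = proj₂ laws

dist-refl : ∀ (u : Word n) → dist u u ≡ 0
dist-refl [] = refl
dist-refl (a ∷ u) with a Fin.≟ a
... | yes _   = dist-refl u
... | no a≢a  = contradiction refl a≢a

dist≡0⇒≡ : ∀ (u v : Word n) → dist u v ≡ 0 → u ≡ v
dist≡0⇒≡ [] [] _ = refl
dist≡0⇒≡ (a ∷ u) (b ∷ v) e with a Fin.≟ b
... | yes refl = cong (a ∷_) (dist≡0⇒≡ u v e)

adjacent-[]≔ : ∀ (x : Word n) i {a b} → a ≢ b → Adjacent (x [ i ]≔ a) (x [ i ]≔ b)
adjacent-[]≔ (_ ∷ x) zero {a} {b} a≢b with a Fin.≟ b
... | yes a≡b = contradiction a≡b a≢b
... | no _    = cong suc (dist-refl x)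
adjacent-[]≔ (y ∷ x) (suc i) a≢b with y Fin.≟ y
... | yes _   = adjacent-[]≔ x i a≢b
... | no y≢y  = contradiction refl y≢y

adjacent⇒[]≔ : ∀ (u v : Word n) → Adjacent u v →
               ∃ λ i → lookup u i ≢ lookup v i × v ≡ u [ i ]≔ lookup v i
adjacent⇒[]≔ [] [] ()
adjacent⇒[]≔ (a ∷ u) (b ∷ v) adj with a Fin.≟ b
... | yes refl = let i , ui≢vi , v≡ = adjacent⇒[]≔ u v adj in suc i , ui≢vi , cong (a ∷_) v≡
... | no a≢b   = zero , a≢b , cong (b ∷_) (sym (dist≡0⇒≡ u v (suc-injective adj)))

along : WSet n → Word n → Fin n → Line
along D x i a = D (x [ i ]≔ a)

-- Sets of words and sums of subfamilies

∅ : WSet n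
∅ _ = false

infixr 7 _∩_ _∖_
infixr 6 _∪_ _⊕_

_∪_ _∩_ _⊕_ _∖_ : WSet n → WSet n → WSet n
(A ∪ B) w = A w ∨ B w
(A ∩ B) w = A w ∧ B w
(A ⊕ B) w = A w xor B w
(A ∖ B) w = A w ∧ not (B w)

⋃ : List (WSet n) → WSet n
⋃ = foldr _∪_ ∅

_≐[_]_ : WSet n → WSet n → WSet n → Set
A ≐[ X ] B = ∀ y → X y ≡ true → A y ≡ B y

Disjoint : WSet n → WSet n → Set
Disjoint A B = ∀ y → A y ≡ true → B y ≡ false

≐-member⊆⋃ : ∀ {C : WSet n} {L} → Any (C ≐_) L → C ⊆ ⋃ L
≐-member⊆⋃ (here C≐A) w Cw = cong (_∨ _) (trans (sym (C≐A w)) Cw)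
≐-member⊆⋃ (there p)  w Cw = trans (cong (_ ∨_) (≐-member⊆⋃ p w Cw)) (∨-zeroʳ _)

⋃-closed : {P : WSet n → Set} → P ∅ → (∀ {A B} → P A → P B → P (A ∪ B)) →
           ∀ {L} → All P L → P (⋃ L)
⋃-closed P∅ P∪ []         = P∅
⋃-closed P∅ P∪ (pA ∷ pL) = P∪ pA (⋃-closed P∅ P∪ pL)

disjoint-⋃ : ∀ {D : WSet n} {L} → All (Disjoint D) L → Disjoint D (⋃ L)
disjoint-⋃ = ⋃-closed (λ _ _ → refl) λ dA dB y Dy → cong₂ _∨_ (dA y Dy) (dB y Dy)

span : List (WSet n) → List (WSet n)
span []      = ∅ ∷ []
span (D ∷ L) = map (D ⊕_) (span L) ++ span L

length-span : ∀ (L : List (WSet n)) → length (span L) ≡ 2 ^ length L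
length-span [] = refl
length-span (D ∷ L) = begin
  length (map (D ⊕_) (span L) ++ span L)          ≡⟨ length-++ (map (D ⊕_) (span L)) ⟩
  length (map (D ⊕_) (span L)) + length (span L)  ≡⟨ cong (_+ _) (length-map (D ⊕_) (span L)) ⟩
  length (span L) + length (span L)               ≡⟨ cong₂ _+_ (length-span L) (length-span L) ⟩
  2 ^ length L + 2 ^ length L                     ≡⟨ cong (2 ^ length L +_) (+-identityʳ _) ⟨
  2 ^ suc (length L)                              ∎
  where open ≡-Reasoning

span-closed : {P : WSet n → Set} → P ∅ → (∀ {A B} → P A → P B → P (A ⊕ B)) →
              ∀ {L} → All P L → All P (span L)
span-closed P∅ P⊕ []        = P∅ ∷ []
span-closed P∅ P⊕ (pD ∷ pL) = All.++⁺ (All.map⁺ (All.map (P⊕ pD) ih)) ih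
  where ih = span-closed P∅ P⊕ pL

disjoint-span : ∀ {D : WSet n} {L} → All (Disjoint D) L → All (Disjoint D) (span L)
disjoint-span = span-closed (λ _ _ → refl) λ dA dB y Dy → cong₂ _xor_ (dA y Dy) (dB y Dy)

span-independent : ∀ {X : WSet n} L → All Nonempty L → All (_⊆ X) L → AllPairs Disjoint L →
                   AllPairs (λ A B → ¬ A ≐[ X ] B) (span L)
span-independent [] [] [] [] = [] ∷ []
span-independent {X = X} (D ∷ L) ((y , Dy) ∷ neL) (D⊆X ∷ L⊆X) (dD ∷ dL) =
  AllPairs.++⁺ (AllPairs.map⁺ (AllPairs.map cancel ih)) ih
    (All.map⁺ (All.map (λ dA → All.map (separated dA) disj) disj))
  where
    ih = span-independent L neL L⊆X dL
    disj = disjoint-span dD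
    cancel : ∀ {A B} → ¬ A ≐[ X ] B → ¬ (D ⊕ A) ≐[ X ] (D ⊕ B)
    cancel A≠B eq = A≠B λ w Xw → xor-cancelˡ (D w) (eq w Xw)
    separated : ∀ {A B} → Disjoint D A → Disjoint D B → ¬ (D ⊕ A) ≐[ X ] B
    separated dA dB eq =
      contradiction (trans (sym (cong₂ _xor_ Dy (dA y Dy))) (trans (eq y (D⊆X y Dy)) (dB y Dy))) λ ()

span-complete : ∀ {f : WSet n} L → All Nonempty L → All (λ D → ConstantOn D f) L →
                AllPairs Disjoint L → Any (_≐ (⋃ L ∩ f)) (span L)
span-complete [] [] [] [] = here λ _ → refl
span-complete {f = f} (D ∷ L) ((y , Dy) ∷ neL) (fD ∷ fL) (dD ∷ dL) =
  extend (f y) refl (span-complete L neL fL dL)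
  where
    D-on-f : ∀ {w b} → f y ≡ b → D w ≡ true → f w ≡ b
    D-on-f fy Dw = trans (fD _ y Dw Dy) fy
    ⋃L-off-D : ∀ {w} → D w ≡ true → ⋃ L w ≡ false
    ⋃L-off-D = disjoint-⋃ dD _
    extend : ∀ b → f y ≡ b → Any (_≐ (⋃ L ∩ f)) (span L) →
             Any (_≐ (⋃ (D ∷ L) ∩ f)) (span (D ∷ L))
    extend true  fy = Any.++⁺ˡ ∘ Any.map⁺ ∘ Any.map add
      where
        add : ∀ {A} → A ≐ (⋃ L ∩ f) → (D ⊕ A) ≐ (⋃ (D ∷ L) ∩ f)
        add {A} A≐ w with D w in Dw
        ... | true  = begin
          not (A w)           ≡⟨ cong not (A≐ w) ⟩
          not (⋃ L w ∧ f w)   ≡⟨ cong (λ b → not (b ∧ f w)) (⋃L-off-D Dw) ⟩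
          true                ≡⟨ D-on-f fy Dw ⟨
          f w                 ∎
          where open ≡-Reasoning
        ... | false = A≐ w
    extend false fy = Any.++⁺ʳ _ ∘ Any.map skip
      where
        skip : ∀ {A} → A ≐ (⋃ L ∩ f) → A ≐ (⋃ (D ∷ L) ∩ f)
        skip A≐ w with D w in Dw
        ... | true  = trans (A≐ w) (trans (cong (_∧ f w) (⋃L-off-D Dw)) (sym (D-on-f fy Dw)))
        ... | false = A≐ w

size : WSet n → ℕ
size {zero}  D = b2n (D [])
size {suc n} D = ∑₄ λ a → size (D ∘ (a ∷_))

b2n-mono : ∀ {a b} → (a ≡ true → b ≡ true) → b2n a ≤ b2n b
b2n-mono {false} _ = z≤n
b2n-mono {true}  h rewrite h refl = ≤-refl

size-mono : {P D : WSet n} → P ⊆ D → size P ≤ size D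
size-mono {zero}  P⊆D = b2n-mono (P⊆D [])
size-mono {suc n} P⊆D = ∑₄-mono-≤ λ a → size-mono (P⊆D ∘ (a ∷_))

size-< : {P D : WSet n} → P ⊆ D → ∀ y → D y ≡ true → P y ≡ false → size P < size D
size-< {zero}  _   []      Dy Py rewrite Dy | Py = s≤s z≤n
size-< {suc n} P⊆D (a ∷ y) Dy Py =
  ∑₄-mono-< (λ b → size-mono (P⊆D ∘ (b ∷_))) a (size-< (P⊆D ∘ (a ∷_)) y Dy Py)

splitting-head-⊆ : ∀ {D P : WSet n} {Ps} → IsSplitting D (P ∷ Ps) → P ⊆ D
splitting-head-⊆ {P = P} split w Pw = suc≡b2n⇒true (subst (λ b → b2n b + _ ≡ _) Pw (split w))

splitting-second : ∀ {D P Q : WSet n} {Ps} → IsSplitting D (P ∷ Q ∷ Ps) →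
                   ∀ {y} → Q y ≡ true → P y ≡ false × D y ≡ true
splitting-second {P = P} {Q} split {y} Qy =
  b2n-+-suc (P y) (subst (λ b → b2n (P y) + (b2n b + _) ≡ _) Qy (split y))

-- Inside a double-MDS-code

module DoubleMDS {n : ℕ} (S : WSet n) (isDoubleMDS : IsDoubleMDS S) where

  ConstantOnLines : WSet n → Set
  ConstantOnLines f = ∀ x i → ConstantOn (along S x i) (along f x i)

  InjectiveOnLines : WSet n → Set
  InjectiveOnLines f = ∀ x i → InjectiveOn (along S x i) (along f x i)

  lineLaws-along : ∀ {D} → D ⊆ S → ∀ x i →
    (ZeroOrTwo (lineCount D x i) ⇔ ConstantOn (along S x i) (along D x i)) ×
    (lineCount D x i ≡ 1 ⇔ InjectiveOn (along S x i) (along D x i))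
  lineLaws-along {D} D⊆S x i = lineLaws (along S x i) (along D x i) (isDoubleMDS x i) (λ _ → D⊆S _)

  doubleCode⇔constantOnLines : ∀ {D} → D ⊆ S → IsDoubleCode D ⇔ ConstantOnLines D
  doubleCode⇔constantOnLines {D} D⊆S = mk⇔
    (λ dc x i → to   (proj₁ (lineLaws-along {D} D⊆S x i)) (dc x i))
    (λ c  x i → from (proj₁ (lineLaws-along {D} D⊆S x i)) (c x i))

  mds⇔injectiveOnLines : ∀ {C} → C ⊆ S → IsMDS C ⇔ InjectiveOnLines C
  mds⇔injectiveOnLines {C} C⊆S = mk⇔
    (λ m x i → to   (proj₂ (lineLaws-along {C} C⊆S x i)) (m x i))
    (λ c x i → from (proj₂ (lineLaws-along {C} C⊆S x i)) (c x i))

  constantOnLines-∅ : ConstantOnLines ∅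
  constantOnLines-∅ _ _ _ _ _ _ = refl

  constantOnLines-S : ConstantOnLines S
  constantOnLines-S _ _ _ _ Sa Sb = trans Sa (sym Sb)

  constantOnLines-zip : ∀ (_∙_ : Bool → Bool → Bool) f g →
                        ConstantOnLines f → ConstantOnLines g → ConstantOnLines (λ w → f w ∙ g w)
  constantOnLines-zip _∙_ _ _ cf cg x i = constantOn-zip _∙_ (cf x i) (cg x i)

  injectiveOnLines-⊕ : ∀ {f g} → InjectiveOnLines f → InjectiveOnLines g →
                       ConstantOnLines (f ⊕ g)
  injectiveOnLines-⊕ if ig x i = injectiveOn-xor (if x i) (ig x i)

  mdsCode : (Word n → Bool) → WSet n → WSet n
  mdsCode c A = S ∩ (c ⊕ A)

  mdsCode-isMDS : ∀ {c A} → InjectiveOnLines c → ConstantOnLines A → IsMDS (mdsCode c A)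
  mdsCode-isMDS {c} {A} ic cA = from (mds⇔injectiveOnLines {mdsCode c A} λ _ → ∧-conicalˡ _ _)
    λ x i → injectiveOn-∧ (injectiveOn-xor-constantOn (ic x i) (cA x i))

  mdsCode-injective : ∀ {c A B} → mdsCode c A ≐ mdsCode c B → A ≐[ S ] B
  mdsCode-injective {c} {A} {B} eq y Sy =
    xor-cancelˡ (c y) (subst (λ s → s ∧ (c y xor A y) ≡ s ∧ (c y xor B y)) Sy (eq y))

  ≐-mdsCode : ∀ {c A C} → C ⊆ S → A ≐[ S ] (c ⊕ C) → C ≐ mdsCode c A
  ≐-mdsCode {c} {A} {C} C⊆S A≐ y with S y in Sy
  ... | true  = sym (trans (cong (c y xor_) (A≐ y Sy)) (xor-involutiveˡ (c y) (C y)))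
  ... | false = ¬-not λ Cy → not-¬ (C⊆S y Cy) Sy

  ProperColouring : (Word n → Bool) → Set
  ProperColouring c = ∀ u v → S u ≡ true → S v ≡ true → Adjacent u v → c u ≢ c v

  properColouring⇒injectiveOnLines : ∀ {c} → ProperColouring c → InjectiveOnLines c
  properColouring⇒injectiveOnLines proper x i a b a≢b Sa Sb =
    proper (x [ i ]≔ a) (x [ i ]≔ b) Sa Sb (adjacent-[]≔ x i a≢b)

  injectiveOnLines⇒properColouring : ∀ {c} → InjectiveOnLines c → ProperColouring c
  injectiveOnLines⇒properColouring {c} ic u v Su Sv adj cu≡cv =
    ic u i (lookup u i) (lookup v i) ui≢vi
      (subst (λ w → S w ≡ true) (sym u≡) Su) (subst (λ w → S w ≡ true) v≡ Sv)
      (trans (cong c u≡) (trans cu≡cv (cong c v≡)))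
    where
      i = proj₁ (adjacent⇒[]≔ u v adj)
      ui≢vi = proj₁ (proj₂ (adjacent⇒[]≔ u v adj))
      v≡ = proj₂ (proj₂ (adjacent⇒[]≔ u v adj))
      u≡ = []≔-lookup u i

  Prime : WSet n → Set
  Prime D = IsPrime D × D ⊆ S

  prime⇒constantOnLines : ∀ {D} → Prime D → ConstantOnLines D
  prime⇒constantOnLines (((dc , _) , _) , D⊆S) = to (doubleCode⇔constantOnLines D⊆S) dc

  prime-nonempty : ∀ {D} → Prime D → Nonempty D
  prime-nonempty ((_ , ne , _) , _) = ne

  splittable-by : ∀ {D f y z} → IsDoubleCode D → D ⊆ S → ConstantOnLines f →
                  D y ≡ true → D z ≡ true → f y ≡ true → f z ≡ false → IsSplittable D
  splittable-by {D} {f} {y} {z} dc D⊆S cf Dy Dz fy fz =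
      D ∩ f ∷ D ∖ f ∷ []
    , s≤s (s≤s z≤n)
    , (from (doubleCode⇔constantOnLines (part⊆S f)) (constantOnLines-zip _∧_ D f cD cf)
        , y , cong₂ _∧_ Dy fy)
      ∷ (from (doubleCode⇔constantOnLines (part⊆S (not ∘ f)))
              (constantOnLines-zip (λ a b → a ∧ not b) D f cD cf)
        , z , cong₂ (λ a b → a ∧ not b) Dz fz)
      ∷ []
    , λ w → b2n-∧-split (D w) (f w)
    where
      cD = to (doubleCode⇔constantOnLines D⊆S) dc
      part⊆S : ∀ g → (λ w → D w ∧ g w) ⊆ S
      part⊆S _ w = D⊆S w ∘ ∧-conicalˡ _ _

  prime-constantOn : ∀ {D f} → Prime D → ConstantOnLines f → ConstantOn D f
  prime-constantOn {f = f} (((dc , _) , _ , unsplittable) , D⊆S) cf y z Dy Dz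
    with f y in fy | f z in fz
  ... | true  | true  = refl
  ... | false | false = refl
  ... | true  | false = ⊥-elim (unsplittable (splittable-by dc D⊆S cf Dy Dz fy fz))
  ... | false | true  = ⊥-elim (unsplittable (splittable-by dc D⊆S cf Dz Dy fz fy))

  primes-meeting-≐ : ∀ {D E y} → Prime D → Prime E → D y ≡ true → E y ≡ true → D ≐ E
  primes-meeting-≐ {y = y} pD pE Dy Ey w = ⇔→≡ (mk⇔
    (λ Dw → trans (prime-constantOn pD (prime⇒constantOnLines pE) w y Dw Dy) Ey)
    (λ Ew → trans (prime-constantOn pE (prime⇒constantOnLines pD) w y Ew Ey) Dy))

  primes-disjoint : ∀ {D E} → Prime D → Prime E → ¬ D ≐ E → Disjoint D E
  primes-disjoint pD pE D≠E y Dy = ¬-not λ Ey → D≠E (primes-meeting-≐ pD pE Dy Ey)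

  primes-pairwise-disjoint : ∀ {L} → All Prime L → AllPairs (λ A B → ¬ A ≐ B) L →
                             AllPairs Disjoint L
  primes-pairwise-disjoint []          []            = []
  primes-pairwise-disjoint (pD ∷ pL) (D≠L ∷ distinct) =
    All.zipWith (uncurry (primes-disjoint pD)) (pL , D≠L) ∷ primes-pairwise-disjoint pL distinct

  -- Primality quantifies over all splittings and is not decidable, so only the double negation
  -- is available; it suffices in primes-cover because membership in ⋃ L is decidable.
  ¬¬-prime-⊆ : ∀ {D} → IsDoubleCode D → D ⊆ S → Nonempty D →
               ¬ ¬ ∃ λ P → IsPrime P × P ⊆ D
  ¬¬-prime-⊆ {D} = bounded (suc (size D)) ≤-refl
    where
      bounded : ∀ k {D} → size D < k → IsDoubleCode D → D ⊆ S → Nonempty D →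
                ¬ ¬ ∃ λ P → IsPrime P × P ⊆ D
      bounded (suc k) {D} |D|<k dc D⊆S ne ∄P =
        ∄P (D , ((dc , S , isDoubleMDS , D⊆S) , ne , unsplittable) , λ _ Dw → Dw)
        where
          unsplittable : ¬ IsSplittable D
          unsplittable ([] , () , _)
          unsplittable (_ ∷ [] , s≤s () , _)
          unsplittable (P₁ ∷ P₂ ∷ Ps , _ , (dc₁ , ne₁) ∷ (_ , y , P₂y) ∷ _ , split) =
            bounded k (<-≤-trans (size-< P₁⊆D y Dy P₁y) (≤-pred |D|<k)) dc₁
              (λ w → D⊆S w ∘ P₁⊆D w) ne₁
              λ (P , isPrime , P⊆P₁) → ∄P (P , isPrime , λ w → P₁⊆D w ∘ P⊆P₁ w)
            where
              P₁⊆D = splitting-head-⊆ {D = D} {P₁} {P₂ ∷ Ps} split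
              P₁y = proj₁ (splitting-second {D = D} {P₁} {P₂} {Ps} split P₂y)
              Dy = proj₂ (splitting-second {D = D} {P₁} {P₂} {Ps} split P₂y)

  primes-cover : ∀ L → All Prime L → (∀ P → Prime P → Any (P ≐_) L) → S ⊆ ⋃ L
  primes-cover L primes complete y Sy with ⋃ L y in ⋃Ly
  ... | true  = refl
  ... | false =
    ⊥-elim (¬¬-prime-⊆ T-doubleCode T⊆S (y , cong₂ (λ a b → a ∧ not b) Sy ⋃Ly) no-prime)
    where
      T : WSet n
      T = S ∖ ⋃ L
      T⊆S : T ⊆ S
      T⊆S _ = ∧-conicalˡ _ _
      T-doubleCode : IsDoubleCode T
      T-doubleCode = from (doubleCode⇔constantOnLines T⊆S)
        (constantOnLines-zip (λ a b → a ∧ not b) S (⋃ L) constantOnLines-S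
          (⋃-closed {P = ConstantOnLines} constantOnLines-∅
            (λ {A} {B} → constantOnLines-zip _∨_ A B) (All.map prime⇒constantOnLines primes)))
      no-prime : ¬ ∃ λ P → IsPrime P × P ⊆ T
      no-prime (P , isPrime , P⊆T) =
        not-¬ (≐-member⊆⋃ (complete P (isPrime , λ w → T⊆S w ∘ P⊆T w)) z Pz)
              (not-injective (∧-conicalʳ _ _ (P⊆T z Pz)))
        where
          z = proj₁ (proj₁ (proj₂ isPrime))
          Pz = proj₂ (proj₁ (proj₂ isPrime))

  mdsCodes-count : ∀ {c} L → ProperColouring c →
                   All Prime L → AllPairs (λ A B → ¬ A ≐ B) L → (∀ P → Prime P → Any (P ≐_) L) →
                   HasCount (λ C → IsMDS C × C ⊆ S) (2 ^ length L)
  mdsCodes-count {c} L proper primes distinct complete =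
      map (mdsCode c) (span L)
    , trans (length-map (mdsCode c) (span L)) (length-span L)
    , All.map⁺ (All.map (λ {A} cA → mdsCode-isMDS {c} {A} ic cA , λ _ → ∧-conicalˡ _ _)
                        span-constant)
    , AllPairs.map⁺ (AllPairs.map (λ {A} {B} A≠B → A≠B ∘ mdsCode-injective {c} {A} {B})
                                  span-distinct)
    , λ C (isMDS , C⊆S) → Any.map⁺ (Any.map (λ {A} A≐ → ≐-mdsCode {c} {A} {C} C⊆S (on-S A≐))
                                            (span-reaches C isMDS C⊆S))
    where
      ic = properColouring⇒injectiveOnLines proper
      nonempty = All.map prime-nonempty primes
      disjoint = primes-pairwise-disjoint primes distinct

      span-constant : All ConstantOnLines (span L)
      span-constant = span-closed {P = ConstantOnLines} constantOnLines-∅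
        (λ {A} {B} → constantOnLines-zip _xor_ A B) (All.map prime⇒constantOnLines primes)

      span-distinct : AllPairs (λ A B → ¬ A ≐[ S ] B) (span L)
      span-distinct = span-independent L nonempty (All.map proj₂ primes) disjoint

      span-reaches : ∀ C → IsMDS C → C ⊆ S → Any (_≐ (⋃ L ∩ (c ⊕ C))) (span L)
      span-reaches C isMDS C⊆S =
        span-complete L nonempty (All.map (λ pD → prime-constantOn pD c⊕C) primes) disjoint
        where c⊕C = injectiveOnLines-⊕ {c} {C} ic (to (mds⇔injectiveOnLines C⊆S) isMDS)

      on-S : ∀ {A f} → A ≐ (⋃ L ∩ f) → A ≐[ S ] f
      on-S {A} {f} A≐ y Sy = trans (A≐ y) (cong (_∧ f y) (primes-cover L primes complete y Sy))

proposition5 : (n : ℕ) (S : WSet n) → IsDoubleMDS S →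
    (γ : ℕ) → HasCount (λ D → IsPrime D × D ⊆ S) γ →
    (IsBipartite S → HasCount (λ C → IsMDS C × C ⊆ S) (2 ^ γ)) ×
    (¬ IsBipartite S → ∀ C → IsMDS C → ¬ (C ⊆ S))
proposition5 n S isDoubleMDS γ (L , |L|≡γ , primes , distinct , complete) = bipartite , nonBipartite
  where
    open DoubleMDS S isDoubleMDS

    bipartite : IsBipartite S → HasCount (λ C → IsMDS C × C ⊆ S) (2 ^ γ)
    bipartite (c , proper) =
      subst (HasCount (λ C → IsMDS C × C ⊆ S) ∘ (2 ^_)) |L|≡γ
        (mdsCodes-count L proper primes distinct complete)

    nonBipartite : ¬ IsBipartite S → ∀ C → IsMDS C → ¬ (C ⊆ S)
    nonBipartite ¬bipartite C isMDS C⊆S =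
      ¬bipartite (C , injectiveOnLines⇒properColouring (to (mds⇔injectiveOnLines C⊆S) isMDS))
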